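{- Let $\mathrm{XORUnification}$ be the XOR-unification algorithm described in the context. For every unification problem $P$, if $P$ is unifiable (there exists a substitution solving $P$), then $\mathrm{XORUnification}(P)$ returns some substitution (i.e. does not return None).
   Context: Terms are built from constants $C(n)$ ($n\in\mathbb{N}$), variables (indexed by strings), and a binary operator $\oplus$; the constant $0:=C(0)$ is the unit. The relation $\approx_{XOR}$ is the smallest congruence on terms (reflexive, symmetric, transitive, compatible with $\oplus$) containing associativity $(x\oplus y)\oplus z\approx x\oplus(y\oplus z)$, commutativity $x\oplus y\approx y\oplus x$, unity $0\oplus x\approx x$ and nilpotency $x\oplus x\approx 0$. A substitution maps variables to terms (identity on all but finitely many) and is extended homomorphically to terms. A unification problem is a finite list of equations $s\approx^? t$; a substitution solves it if $\sigma(s)\approx_{XOR}\sigma(t)$ for each equation. The algorithm $\mathrm{XORUnification}$: each equation $s\approx^?t$ is rewritten as $s\oplus t\approx^?0$ and the left side is put in a normal form modulo $\approx_{XOR}$ (a list of atoms with cancelled duplicate pairs and removed $0$'s); one starts with the pair $\Gamma\|\Lambda$ with $\Gamma$ these equations and $\Lambda=\emptyset$, and repeatedly applies the first applicable of the rules (Trivial) $\Gamma\cup\{0\approx^?0\}\|\Lambda\ \Rightarrow\ \Gamma\|\Lambda$ and (Variable Substitution) $\Gamma\cup\{x\oplus S\approx^?0\}\|\Lambda\ \Rightarrow\ \sigma\Gamma\|\sigma\Lambda\cup\{x\approx^?S\}$, where $x$ is a variable not occurring in $S$ and $\sigma=\{x\mapsto S\}$ (results re-normalized). When no rule applies, if $\Gamma$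 is empty the algorithm returns the substitution $\{x\mapsto S : (x\approx^?S)\in\Lambda\}$, and otherwise returns None. -}

module Defs where

open import Data.Nat using (ℕ; zero; suc)
import Data.Nat.Properties as ℕP
open import Data.String using (String)
import Data.String.Properties as SP
open import Data.List using (List; []; _∷_; length; foldl; foldr; map)
open import Data.List.Relation.Unary.All using (All)
open import Data.Maybe using (Maybe; just; nothing)
open import Data.Product using (_×_; _,_; Σ; ∃)
open import Data.Bool using (Bool; true; false)
open import Relation.Nullary using (yes; no; Dec)
open import Relation.Binary.PropositionalEquality using (_≡_; refl; cong)

data Term : Set where
  C   : ℕ → Term
  V   : String → Term
  _⊕_ : Term → Term → Term

infixl 6 _⊕_

𝟘 : Term
𝟘 = C 0

infix 4 _≈X_

data _≈X_ : Term → Term → Set where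
  ≈refl  : ∀ {s} → s ≈X s
  ≈sym   : ∀ {s t} → s ≈X t → t ≈X s
  ≈trans : ∀ {s t u} → s ≈X t → t ≈X u → s ≈X u
  ≈cong  : ∀ {s s′ t t′} → s ≈X s′ → t ≈X t′ → (s ⊕ t) ≈X (s′ ⊕ t′)
  ≈assoc : ∀ x y z → ((x ⊕ y) ⊕ z) ≈X (x ⊕ (y ⊕ z))
  ≈comm  : ∀ x y → (x ⊕ y) ≈X (y ⊕ x)
  ≈unit  : ∀ x → (𝟘 ⊕ x) ≈X x
  ≈nil   : ∀ x → (x ⊕ x) ≈X 𝟘

Subst : Set
Subst = List (String × Term)

lookupVar : Subst → String → Term
lookupVar []             x = V x
lookupVar ((y , t) ∷ σ) x with x SP.≟ y
... | yes _ = t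
... | no  _ = lookupVar σ x

applySubst : Subst → Term → Term
applySubst σ (C n)   = C n
applySubst σ (V x)   = lookupVar σ x
applySubst σ (s ⊕ t) = applySubst σ s ⊕ applySubst σ t

Equation : Set
Equation = Term × Term

Problem : Set
Problem = List Equation

Solves : Subst → Problem → Set
Solves σ P = All (λ { (s , t) → applySubst σ s ≈X applySubst σ t }) P

Unifiable : Problem → Set
Unifiable P = Σ Subst λ σ → Solves σ P

-- Normal forms modulo XOR: lists of atoms, duplicate pairs cancelled,
-- 0's removed.

data Atom : Set where
  cst : ℕ → Atom        -- C(n) with n ≠ 0
  var : String → Atom

_≟A_ : (a b : Atom) → Dec (a ≡ b)
cst m ≟A cst n with m ℕP.≟ n
... | yes refl = yes refl
... | no  m≢n  = no λ { refl → m≢n refl }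
cst _ ≟A var _ = no λ ()
var _ ≟A cst _ = no λ ()
var x ≟A var y with x SP.≟ y
... | yes refl = yes refl
... | no  x≢y  = no λ { refl → x≢y refl }

flatten : Term → List Atom
flatten (C zero)    = []
flatten (C (suc n)) = cst (suc n) ∷ []
flatten (V x)       = var x ∷ []
flatten (s ⊕ t)     = flatten s Data.List.++ flatten t

toggle : List Atom → Atom → List Atom
toggle []       a = a ∷ []
toggle (b ∷ bs) a with a ≟A b
... | yes _ = bs
... | no  _ = b ∷ toggle bs a

NF : Set
NF = List Atom

nf : Term → NF
nf t = foldl toggle [] (flatten t)

atomTerm : Atom → Term
atomTerm (cst n) = C n
atomTerm (var x) = V x

nfTerm : NF → Term
nfTerm = foldr (λ a t → atomTerm a ⊕ t) 𝟘

-- Γ : equations S ≈? 0, stored by their normalized left side S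
-- Λ : solved equations x ≈? S

Solved : Set
Solved = List (String × NF)

substNF : String → NF → NF → NF
substNF x S A = nf (applySubst ((x , nfTerm S) ∷ []) (nfTerm A))

-- (Trivial): remove the first equation 0 ≈? 0, if any
removeTrivial : List NF → Maybe (List NF)
removeTrivial []        = nothing
removeTrivial ([] ∷ Γ)  = just Γ
removeTrivial (A ∷ Γ) with removeTrivial Γ
... | just Γ′ = just (A ∷ Γ′)
... | nothing = nothing

firstVar : NF → Maybe (String × NF)
firstVar []            = nothing
firstVar (var x ∷ as)  = just (x , as)
firstVar (cst n ∷ as) with firstVar as
... | just (x , S) = just (x , cst n ∷ S)
... | nothing      = nothing

-- (Variable Substitution): first equation x ⊕ S ≈? 0 having a variable x
-- (in a normal form each atom occurs once, so x does not occur in S);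
-- returns x, S and the remaining equations
findVarEq : List NF → Maybe (String × NF × List NF)
findVarEq []      = nothing
findVarEq (A ∷ Γ) with firstVar A
... | just (x , S) = just (x , S , Γ)
... | nothing with findVarEq Γ
...   | just (x , S , Γ′) = just (x , S , A ∷ Γ′)
...   | nothing           = nothing

finish : List NF → Solved → Maybe Subst
finish []      Λ = just (map (λ { (x , S) → x , nfTerm S }) Λ)
finish (_ ∷ _) Λ = nothing

-- each rule removes exactly one equation from Γ, so fuel = |Γ| suffices
run : ℕ → List NF → Solved → Maybe Subst
run zero    Γ Λ = finish Γ Λ
run (suc k) Γ Λ with removeTrivial Γ
... | just Γ′ = run k Γ′ Λ
... | nothing with findVarEq Γ
...   | just (x , S , Γ′) =
          run k (map (substNF x S) Γ′)
                ((x , S) ∷ map (λ { (y , T) → y , substNF x S T }) Λ)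
...   | nothing = finish Γ Λ

XORUnification : Problem → Maybe Subst
XORUnification P = run (length Γ) Γ []
  where Γ = map (λ { (s , t) → nf (s ⊕ t) }) P

Returns : Maybe Subst → Set
Returns r = ∃ λ σ → r ≡ just σ

module Submission where

-- Interpret terms in the Boolean group of subsets of ℕ under symmetric
-- difference, sending a constant C(n) with n ≠ 0 to the singleton {n}; this
-- is a model of XOR in which distinct nonzero constants are independent.
-- A unifier σ yields a valuation v (σ followed by sending every remaining
-- variable to ∅) under which every equation of the problem holds.  Each rule
-- of the algorithm preserves the invariant "every pending equation is a
-- normal form that holds under v": for Variable Substitution because the
-- chosen equation x ⊕ S ≈ 0 forces v(x) = v(S).  When no rule applies, a
-- pending equation would be a nonempty sum of distinct nonzero constants,
-- which contains its first constant and so cannot denote ∅; hence nothing is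
-- pending and the algorithm returns a substitution.

open import Defs
open import Data.Nat using (ℕ; zero; suc; _≟_)
open import Data.Nat.Properties using (suc-injective)
open import Data.String using (String)
import Data.String.Properties as String
open import Data.List using (List; []; _∷_; length; foldl; map; _++_)
open import Data.List.Properties using (foldl-++; length-map)
open import Data.List.Relation.Unary.All as All using (All; []; _∷_)
open import Data.List.Relation.Unary.All.Properties using (++⁺; map⁺)
open import Data.List.Relation.Unary.AllPairs using ([]; _∷_)
open import Data.List.Relation.Unary.Unique.Propositional using (Unique)
open import Data.Maybe using (just; nothing)
open import Data.Product using (_×_; _,_; ∃)
open import Data.Bool using (Bool; true; false; _xor_)
open import Data.Bool.Properties using (xor-same; xor-assoc; xor-comm; xor-identityʳ)
open import Data.Unit using (⊤; tt)
open import Data.Empty using (⊥; ⊥-elim)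
open import Relation.Nullary using (yes; no; does; ¬_)
open import Relation.Nullary.Decidable using (dec-true; dec-false)
open import Relation.Binary.PropositionalEquality

xor-left-comm : ∀ a b c → a xor (b xor c) ≡ b xor (a xor c)
xor-left-comm false b     c     = refl
xor-left-comm true  false c     = refl
xor-left-comm true  true  c     = refl

xor-cancelʳ : ∀ a b → (a xor b) xor a ≡ b
xor-cancelʳ false false = refl
xor-cancelʳ false true  = refl
xor-cancelʳ true  false = refl
xor-cancelʳ true  true  = refl

xor≡false⇒≡ : ∀ {a b} → a xor b ≡ false → a ≡ b
xor≡false⇒≡ {false} {false} _  = refl
xor≡false⇒≡ {false} {true}  ()
xor≡false⇒≡ {true}  {false} ()
xor≡false⇒≡ {true}  {true}  _  = refl

Valuation : Set
Valuation = String → ℕ → Bool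

private
  variable
    s t : Term
    v w : Valuation
    x : String
    S A : NF
    Γ′ : List NF

-- C 0 must denote ∅, the unit.
⟦C_⟧ : ℕ → ℕ → Bool
⟦C zero  ⟧ k = false
⟦C suc n ⟧ k = does (suc n ≟ k)

⟦_⟧ : Term → Valuation → ℕ → Bool
⟦ C n   ⟧ v = ⟦C n ⟧
⟦ V y   ⟧ v = v y
⟦ s ⊕ t ⟧ v k = ⟦ s ⟧ v k xor ⟦ t ⟧ v k

≈X-sound : s ≈X t → ∀ v k → ⟦ s ⟧ v k ≡ ⟦ t ⟧ v k
≈X-sound ≈refl          v k = refl
≈X-sound (≈sym p)       v k = sym (≈X-sound p v k)
≈X-sound (≈trans p q)   v k = trans (≈X-sound p v k) (≈X-sound q v k)
≈X-sound (≈cong p q)    v k = cong₂ _xor_ (≈X-sound p v k) (≈X-sound q v k)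
≈X-sound (≈assoc s t u) v k = xor-assoc (⟦ s ⟧ v k) (⟦ t ⟧ v k) (⟦ u ⟧ v k)
≈X-sound (≈comm s t)    v k = xor-comm (⟦ s ⟧ v k) (⟦ t ⟧ v k)
≈X-sound (≈unit s)      v k = refl
≈X-sound (≈nil s)       v k = xor-same (⟦ s ⟧ v k)

⟦_⟧-cong : ∀ t → (∀ y k → v y k ≡ w y k) → ∀ k → ⟦ t ⟧ v k ≡ ⟦ t ⟧ w k
⟦ C n   ⟧-cong v≐w k = refl
⟦ V y   ⟧-cong v≐w k = v≐w y k
⟦ s ⊕ t ⟧-cong v≐w k = cong₂ _xor_ (⟦ s ⟧-cong v≐w k) (⟦ t ⟧-cong v≐w k)

_⊙_ : Subst → Valuation → Valuation
(σ ⊙ v) y = ⟦ lookupVar σ y ⟧ v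

⟦applySubst⟧ : ∀ σ t v k → ⟦ applySubst σ t ⟧ v k ≡ ⟦ t ⟧ (σ ⊙ v) k
⟦applySubst⟧ σ (C n)   v k = refl
⟦applySubst⟧ σ (V y)   v k = refl
⟦applySubst⟧ σ (s ⊕ t) v k = cong₂ _xor_ (⟦applySubst⟧ σ s v k) (⟦applySubst⟧ σ t v k)

⟦_⟧ᵃ : Atom → Valuation → ℕ → Bool
⟦ a ⟧ᵃ = ⟦ atomTerm a ⟧

⟦_⟧ⁿ : NF → Valuation → ℕ → Bool
⟦ A ⟧ⁿ = ⟦ nfTerm A ⟧

⟦toggle⟧ : ∀ bs a v k → ⟦ toggle bs a ⟧ⁿ v k ≡ ⟦ bs ⟧ⁿ v k xor ⟦ a ⟧ᵃ v k
⟦toggle⟧ []       a v k = xor-identityʳ (⟦ a ⟧ᵃ v k)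
⟦toggle⟧ (b ∷ bs) a v k with a ≟A b
... | yes refl = sym (xor-cancelʳ (⟦ a ⟧ᵃ v k) (⟦ bs ⟧ⁿ v k))
... | no _     = begin
  ⟦ b ⟧ᵃ v k xor ⟦ toggle bs a ⟧ⁿ v k              ≡⟨ cong (⟦ b ⟧ᵃ v k xor_) (⟦toggle⟧ bs a v k) ⟩
  ⟦ b ⟧ᵃ v k xor (⟦ bs ⟧ⁿ v k xor ⟦ a ⟧ᵃ v k)      ≡⟨ xor-assoc (⟦ b ⟧ᵃ v k) _ _ ⟨
  (⟦ b ⟧ᵃ v k xor ⟦ bs ⟧ⁿ v k) xor ⟦ a ⟧ᵃ v k      ∎
  where open ≡-Reasoning

⟦foldl-toggle⟧ : ∀ t acc v k → ⟦ foldl toggle acc (flatten t) ⟧ⁿ v k ≡ ⟦ acc ⟧ⁿ v k xor ⟦ t ⟧ v k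
⟦foldl-toggle⟧ (C zero)    acc v k = sym (xor-identityʳ (⟦ acc ⟧ⁿ v k))
⟦foldl-toggle⟧ (C (suc n)) acc v k = ⟦toggle⟧ acc (cst (suc n)) v k
⟦foldl-toggle⟧ (V y)       acc v k = ⟦toggle⟧ acc (var y) v k
⟦foldl-toggle⟧ (s ⊕ t)     acc v k = begin
  ⟦ foldl toggle acc (flatten s ++ flatten t) ⟧ⁿ v k       ≡⟨ cong (λ B → ⟦ B ⟧ⁿ v k) (foldl-++ toggle acc (flatten s) (flatten t)) ⟩
  ⟦ foldl toggle acc′ (flatten t) ⟧ⁿ v k                   ≡⟨ ⟦foldl-toggle⟧ t acc′ v k ⟩
  ⟦ acc′ ⟧ⁿ v k xor ⟦ t ⟧ v k                              ≡⟨ cong (_xor ⟦ t ⟧ v k) (⟦foldl-toggle⟧ s acc v k) ⟩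
  (⟦ acc ⟧ⁿ v k xor ⟦ s ⟧ v k) xor ⟦ t ⟧ v k               ≡⟨ xor-assoc (⟦ acc ⟧ⁿ v k) _ _ ⟩
  ⟦ acc ⟧ⁿ v k xor (⟦ s ⟧ v k xor ⟦ t ⟧ v k)               ∎
  where
  open ≡-Reasoning
  acc′ : NF
  acc′ = foldl toggle acc (flatten s)

⟦nf⟧ : ∀ t v k → ⟦ nf t ⟧ⁿ v k ≡ ⟦ t ⟧ v k
⟦nf⟧ t = ⟦foldl-toggle⟧ t []

NonZeroAtom : Atom → Set
NonZeroAtom (cst zero)    = ⊥
NonZeroAtom (cst (suc _)) = ⊤
NonZeroAtom (var _)       = ⊤

Normal : NF → Set
Normal A = All NonZeroAtom A × Unique A

toggle-All : ∀ {P : Atom → Set} bs a → All P bs → P a → All P (toggle bs a)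
toggle-All []       a []         pa = pa ∷ []
toggle-All (b ∷ bs) a (pb ∷ pbs) pa with a ≟A b
... | yes _ = pbs
... | no  _ = pb ∷ toggle-All bs a pbs pa

toggle-Unique : ∀ bs a → Unique bs → Unique (toggle bs a)
toggle-Unique []       a []         = [] ∷ []
toggle-Unique (b ∷ bs) a (b∉bs ∷ u) with a ≟A b
... | yes _   = u
... | no  a≢b = toggle-All bs a b∉bs (λ b≡a → a≢b (sym b≡a)) ∷ toggle-Unique bs a u

flatten-nonZero : ∀ t → All NonZeroAtom (flatten t)
flatten-nonZero (C zero)    = []
flatten-nonZero (C (suc n)) = tt ∷ []
flatten-nonZero (V y)       = tt ∷ []
flatten-nonZero (s ⊕ t)     = ++⁺ (flatten-nonZero s) (flatten-nonZero t)

foldl-toggle-normal : ∀ as acc → All NonZeroAtom as → Normal acc → Normal (foldl toggle acc as)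
foldl-toggle-normal []       acc []       n         = n
foldl-toggle-normal (a ∷ as) acc (na ∷ nas) (nz , u) =
  foldl-toggle-normal as (toggle acc a) nas (toggle-All acc a nz na , toggle-Unique acc a u)

nf-normal : ∀ t → Normal (nf t)
nf-normal t = foldl-toggle-normal (flatten t) [] (flatten-nonZero t) ([] , [])

Satisfied : Valuation → NF → Set
Satisfied v A = ∀ k → ⟦ A ⟧ⁿ v k ≡ false

Invariant : Valuation → NF → Set
Invariant v A = Normal A × Satisfied v A

⟦C⟧-off : ∀ m n → m ≢ n → ⟦C m ⟧ n ≡ false
⟦C⟧-off zero    n _   = refl
⟦C⟧-off (suc m) n m≢n = dec-false (suc m ≟ n) m≢n

constants-off : ∀ n as → firstVar as ≡ nothing → All (cst n ≢_) as → ⟦ as ⟧ⁿ v n ≡ false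
constants-off n []           _  []          = refl
constants-off n (var y ∷ as) () _
constants-off {v} n (cst m ∷ as) noVar (n≢m ∷ n∉as) with firstVar as in eq
constants-off n (cst m ∷ as) () _ | just _
... | nothing = cong₂ _xor_ (⟦C⟧-off m n (λ m≡n → n≢m (cong cst (sym m≡n)))) (constants-off {v} n as eq n∉as)

-- A stuck equation, i.e. a nonempty normal form without variables, contains
-- its first constant n exactly once and therefore fails at n.
stuck-unsatisfiable : ∀ A → A ≢ [] → firstVar A ≡ nothing → Normal A → ¬ Satisfied v A
stuck-unsatisfiable []                 A≢[] _  _ _ = A≢[] refl
stuck-unsatisfiable (var y ∷ as)       _    () _ _
stuck-unsatisfiable (cst zero ∷ as)    _    _  (() ∷ _ , _) _
stuck-unsatisfiable {v} (cst (suc n) ∷ as) _ noVar (_ , n∉as ∷ _) sat with firstVar as in eq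
stuck-unsatisfiable (cst (suc n) ∷ as) _ () _ _ | just _
... | nothing = true≢false (begin
  true                                        ≡⟨ cong₂ _xor_ (dec-true (suc n ≟ suc n) refl) (constants-off {v} (suc n) as eq n∉as) ⟨
  ⟦C suc n ⟧ (suc n) xor ⟦ as ⟧ⁿ v (suc n)    ≡⟨ sat (suc n) ⟩
  false                                       ∎)
  where
  open ≡-Reasoning
  true≢false : true ≢ false
  true≢false ()

firstVar-just : ∀ A → firstVar A ≡ just (x , S) → ∀ v k → ⟦ A ⟧ⁿ v k ≡ v x k xor ⟦ S ⟧ⁿ v k
firstVar-just []           ()
firstVar-just (var y ∷ as) refl v k = refl
firstVar-just (cst n ∷ as) e    v k with firstVar as in eq
firstVar-just (cst n ∷ as) refl v k | just (y , S) =
  trans (cong (⟦C n ⟧ k xor_) (firstVar-just as eq v k)) (xor-left-comm (⟦C n ⟧ k) (v y k) (⟦ S ⟧ⁿ v k))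
firstVar-just (cst n ∷ as) ()   v k | nothing

removeTrivial-just : ∀ {Q : NF → Set} Γ → removeTrivial Γ ≡ just Γ′ → All Q Γ →
                     All Q Γ′ × length Γ ≡ suc (length Γ′)
removeTrivial-just []            ()
removeTrivial-just ([] ∷ Γ)      refl (_ ∷ qs) = qs , refl
removeTrivial-just ((a ∷ A) ∷ Γ) e    (q ∷ qs) with removeTrivial Γ in eq
removeTrivial-just ((a ∷ A) ∷ Γ) refl (q ∷ qs) | just Γ′ =
  let qs′ , len = removeTrivial-just Γ eq qs in q ∷ qs′ , cong suc len
removeTrivial-just ((a ∷ A) ∷ Γ) ()   (q ∷ qs) | nothing

findVarEq-just : ∀ {Q : NF → Set} Γ → findVarEq Γ ≡ just (x , S , Γ′) → All Q Γ →
                 ∃ (λ A → firstVar A ≡ just (x , S) × Q A) × All Q Γ′ × length Γ ≡ suc (length Γ′)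
findVarEq-just []      ()
findVarEq-just (A ∷ Γ) e    (q ∷ qs) with firstVar A in eqA
findVarEq-just (A ∷ Γ) refl (q ∷ qs) | just _ = (A , eqA , q) , qs , refl
findVarEq-just (A ∷ Γ) e    (q ∷ qs) | nothing with findVarEq Γ in eqΓ
findVarEq-just (A ∷ Γ) refl (q ∷ qs) | nothing | just _ =
  let chosen , qs′ , len = findVarEq-just Γ eqΓ qs in chosen , q ∷ qs′ , cong suc len
findVarEq-just (A ∷ Γ) ()   (q ∷ qs) | nothing | nothing

removeTrivial-nothing-head : ∀ A Γ → removeTrivial (A ∷ Γ) ≡ nothing → A ≢ []
removeTrivial-nothing-head [] Γ () refl

findVarEq-nothing-head : ∀ A Γ → findVarEq (A ∷ Γ) ≡ nothing → firstVar A ≡ nothing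
findVarEq-nothing-head A Γ e with firstVar A
findVarEq-nothing-head A Γ e  | nothing = refl
findVarEq-nothing-head A Γ () | just _

singleton-⊙ : ∀ t → (∀ k → v x k ≡ ⟦ t ⟧ v k) → ∀ y k → (((x , t) ∷ []) ⊙ v) y k ≡ v y k
singleton-⊙ {x = x} t vx≐t y k with y String.≟ x
... | yes refl = sym (vx≐t k)
... | no  _    = refl

substNF-invariant : ∀ x S → (∀ k → v x k ≡ ⟦ S ⟧ⁿ v k) → Invariant v A → Invariant v (substNF x S A)
substNF-invariant {v} {A} x S vx≐S (_ , sat) = nf-normal u , λ k → begin
  ⟦ nf u ⟧ⁿ v k       ≡⟨ ⟦nf⟧ u v k ⟩
  ⟦ u ⟧ v k           ≡⟨ ⟦applySubst⟧ σ (nfTerm A) v k ⟩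
  ⟦ A ⟧ⁿ (σ ⊙ v) k    ≡⟨ ⟦ nfTerm A ⟧-cong (singleton-⊙ (nfTerm S) vx≐S) k ⟩
  ⟦ A ⟧ⁿ v k          ≡⟨ sat k ⟩
  false               ∎
  where
  open ≡-Reasoning
  σ : Subst
  σ = (x , nfTerm S) ∷ []
  u : Term
  u = applySubst σ (nfTerm A)

finish-returns : ∀ Γ Λ → removeTrivial Γ ≡ nothing → findVarEq Γ ≡ nothing →
                 All (Invariant v) Γ → Returns (finish Γ Λ)
finish-returns []      Λ _  _  _                    = _ , refl
finish-returns (A ∷ Γ) Λ rt fv ((normal , sat) ∷ _) =
  ⊥-elim (stuck-unsatisfiable A (removeTrivial-nothing-head A Γ rt) (findVarEq-nothing-head A Γ fv) normal sat)

run-returns : ∀ n Γ Λ → length Γ ≡ n → All (Invariant v) Γ → Returns (run n Γ Λ)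
run-returns zero    []      Λ _   _   = _ , refl
run-returns zero    (_ ∷ _) Λ ()  _
run-returns {v} (suc n) Γ   Λ len inv with removeTrivial Γ in rt
... | just Γ′ =
  let inv′ , len′ = removeTrivial-just Γ rt inv
  in run-returns n Γ′ Λ (suc-injective (trans (sym len′) len)) inv′
... | nothing with findVarEq Γ in fv
...   | just (x , S , Γ′) =
  let (A , fvA , _ , satA) , inv′ , len′ = findVarEq-just Γ fv inv
      vx≐S : ∀ k → v x k ≡ ⟦ S ⟧ⁿ v k
      vx≐S k = xor≡false⇒≡ (trans (sym (firstVar-just A fvA v k)) (satA k))
  in run-returns n (map (substNF x S) Γ′) _
       (trans (length-map (substNF x S) Γ′) (suc-injective (trans (sym len′) len)))
       (map⁺ (All.map (substNF-invariant x S vx≐S) inv′))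
...   | nothing = finish-returns Γ Λ rt fv inv

∅ᵛ : Valuation
∅ᵛ _ _ = false

solved-invariant : ∀ σ ((s , t) : Equation) → applySubst σ s ≈X applySubst σ t → Invariant (σ ⊙ ∅ᵛ) (nf (s ⊕ t))
solved-invariant σ (s , t) σs≈σt = nf-normal (s ⊕ t) , λ k → begin
  ⟦ nf (s ⊕ t) ⟧ⁿ ρ k                              ≡⟨ ⟦nf⟧ (s ⊕ t) ρ k ⟩
  ⟦ s ⟧ ρ k xor ⟦ t ⟧ ρ k                          ≡⟨ cong₂ _xor_ (⟦applySubst⟧ σ s ∅ᵛ k) (⟦applySubst⟧ σ t ∅ᵛ k) ⟨
  ⟦ σs ⟧ ∅ᵛ k xor ⟦ σt ⟧ ∅ᵛ k                      ≡⟨ cong (_xor ⟦ σt ⟧ ∅ᵛ k) (≈X-sound σs≈σt ∅ᵛ k) ⟩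
  ⟦ σt ⟧ ∅ᵛ k xor ⟦ σt ⟧ ∅ᵛ k                      ≡⟨ xor-same (⟦ σt ⟧ ∅ᵛ k) ⟩
  false                                            ∎
  where
  open ≡-Reasoning
  ρ : Valuation
  ρ = σ ⊙ ∅ᵛ
  σs σt : Term
  σs = applySubst σ s
  σt = applySubst σ t

mainTheorem4 : (P : Problem) → Unifiable P → Returns (XORUnification P)
mainTheorem4 P (σ , solves) = run-returns _ _ [] refl (map⁺ (All.map (λ {e} → solved-invariant σ e) solves))
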